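{- Suppose $H\in\operatorname{BH}(n,3)$ admits an $H$-bent vector. Then \[ \frac23 n-\frac23\sqrt n\le r(C_H)\le \frac23 n-\frac13\sqrt n. \]
   Context: $\zeta_3=e^{2\pi\sqrt{ -1}/3}$, $\langle\zeta_3\rangle$ the set of cube roots of unity. $\operatorname{BH}(n,3)$ is the set of $n\times n$ matrices $H$ with entries in $\langle\zeta_3\rangle$ and $HH^*=nI_n$. A vector $\mathbf x\in\langle\zeta_3\rangle^n$ is $H$-bent if every entry of $H\mathbf x$ has modulus $\sqrt n$. The logarithmic form $L(H)$ of $H=[\zeta_3^{\varphi_{i,j}}]$ is $[\varphi_{i,j}\bmod 3]$ over $\mathbb{Z}_3$; $R_H$ is the set of rows of $L(H)$ and $C_H=\bigcup_{\alpha\in\mathbb{Z}_3}(R_H+\alpha\mathbf 1)$. The covering radius of $C\subseteq\mathbb{Z}_3^n$ is $r(C)=\max_{\mathbf x\in\mathbb{Z}_3^n}\min_{\mathbf y\in C}d(\mathbf x,\mathbf y)$ with $d$ the Hamming distance. -}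

module Defs where

open import Data.Nat as ℕ using (ℕ; zero; suc)
open import Data.Integer as ℤ using (ℤ; +_; 0ℤ; 1ℤ; -1ℤ)
open import Data.Fin using (Fin; zero; suc)
open import Data.Product using (Σ; _×_; ∃; ∃-syntax)
open import Relation.Binary.PropositionalEquality using (_≡_)
open import Relation.Nullary using (¬_; does)
open import Data.Bool using (if_then_else_)
import Data.Fin

-- Elements of the Eisenstein integers ℤ[ζ₃] ⊂ ℂ, written a + b·ζ₃
-- (1, ζ₃ is a ℤ-basis, so this representation is unique).
record ℤζ : Set where
  constructor _+_ζ
  field
    re : ℤ
    im : ℤ
open ℤζ public

infixl 6 _⊞_
infixl 7 _⊠_

_⊞_ : ℤζ → ℤζ → ℤζ
(a + b ζ) ⊞ (c + d ζ) = (a ℤ.+ c) + (b ℤ.+ d) ζ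

-- (a + bζ)(c + dζ) = ac + (ad+bc)ζ + bd ζ² , with ζ² = -1 - ζ
_⊠_ : ℤζ → ℤζ → ℤζ
(a + b ζ) ⊠ (c + d ζ) =
  (a ℤ.* c ℤ.- b ℤ.* d) + (a ℤ.* d ℤ.+ b ℤ.* c ℤ.- b ℤ.* d) ζ

-- complex conjugation: conj(ζ) = ζ² = -1 - ζ
conj : ℤζ → ℤζ
conj (a + b ζ) = (a ℤ.- b) + (ℤ.- b) ζ

normSq : ℤζ → ℤ
normSq (a + b ζ) = a ℤ.* a ℤ.- a ℤ.* b ℤ.+ b ℤ.* b

embℕ : ℕ → ℤζ
embℕ m = (+ m) + 0ℤ ζ

0ζ : ℤζ
0ζ = 0ℤ + 0ℤ ζ

ζ^ : Fin 3 → ℤζ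
ζ^ zero = 1ℤ + 0ℤ ζ
ζ^ (suc zero) = 0ℤ + 1ℤ ζ
ζ^ (suc (suc zero)) = -1ℤ + -1ℤ ζ

_⊕_ : Fin 3 → Fin 3 → Fin 3
zero ⊕ b = b
suc zero ⊕ zero = suc zero
suc zero ⊕ suc zero = suc (suc zero)
suc zero ⊕ suc (suc zero) = zero
suc (suc zero) ⊕ zero = suc (suc zero)
suc (suc zero) ⊕ suc zero = zero
suc (suc zero) ⊕ suc (suc zero) = suc zero

Σζ : ∀ {n} → (Fin n → ℤζ) → ℤζ
Σζ {zero} f = 0ζ
Σζ {suc n} f = f zero ⊞ Σζ (λ k → f (suc k))

-- A matrix with entries in ⟨ζ₃⟩ is given by its logarithmic form L : Fin n → Fin n → ℤ₃,
-- i.e. H = [ζ₃ ^ L i j].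
entry : ∀ {n} → (Fin n → Fin n → Fin 3) → Fin n → Fin n → ℤζ
entry L i j = ζ^ (L i j)

nδ : ∀ (n : ℕ) → Fin n → Fin n → ℤζ
nδ n i j = if does (i Data.Fin.≟ j) then embℕ n else 0ζ

-- H ∈ BH(n,3):  H H* = n I_n  (entrywise: Σ_k H_ik conj(H_jk) = n δ_ij)
IsBH3 : ∀ (n : ℕ) → (Fin n → Fin n → Fin 3) → Set
IsBH3 n L = ∀ (i j : Fin n) →
  Σζ (λ k → entry L i k ⊠ conj (entry L j k)) ≡ nδ n i j

-- x ∈ ⟨ζ₃⟩ⁿ given by exponents e : Fin n → ℤ₃ (x_k = ζ₃ ^ e k).
-- x is H-bent: every entry of H x has modulus √n, i.e. squared modulus n.
IsBent : ∀ (n : ℕ) → (Fin n → Fin n → Fin 3) → (Fin n → Fin 3) → Set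
IsBent n L e = ∀ (i : Fin n) →
  normSq (Σζ (λ k → entry L i k ⊠ ζ^ (e k))) ≡ + n

dec≡ : Fin 3 → Fin 3 → ℕ
dec≡ zero zero = 0
dec≡ (suc zero) (suc zero) = 0
dec≡ (suc (suc zero)) (suc (suc zero)) = 0
dec≡ _ _ = 1

hamming : ∀ {n} → (Fin n → Fin 3) → (Fin n → Fin 3) → ℕ
hamming {zero} x y = 0
hamming {suc n} x y = dec≡ (x zero) (y zero) ℕ.+ hamming (λ k → x (suc k)) (λ k → y (suc k))

-- C_H = ⋃_{α ∈ ℤ₃} (R_H + α·1), indexed by (row i, shift α)
codeword : ∀ {n} → (Fin n → Fin n → Fin 3) → Fin n → Fin 3 → (Fin n → Fin 3)
codeword L i α k = L i k ⊕ α

-- r is the covering radius of a code C ⊆ ℤ₃ⁿ given as an indexed family c : I → ℤ₃ⁿ: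
-- r = max_x min_{y ∈ C} d(x,y).
IsCoveringRadius : ∀ {n} {I : Set} → (I → (Fin n → Fin 3)) → ℕ → Set
IsCoveringRadius {n} {I} c r =
  (∀ (x : Fin n → Fin 3) → ∃[ y ] hamming x (c y) ℕ.≤ r) ×
  (∃[ x ] ∀ (y : I) → r ℕ.≤ hamming x (c y))

CoveringRadiusCH : ∀ (n : ℕ) → (Fin n → Fin n → Fin 3) → ℕ → Set
CoveringRadiusCH n L r =
  IsCoveringRadius {n} {Fin n × Fin 3} (λ p → codeword L (Data.Product.proj₁ p) (Data.Product.proj₂ p)) r

{-# OPTIONS --safe #-}

-- For a row h of L(H) and a word x put t = h − x and let d_β be the distance of t to the
-- constant word β; then d(x, h + α) = d_{−α} and d₀ + d₁ + d₂ = 2n.  The character sum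
-- ∑ₖ ζ^{h k} conj(ζ^{x k}) = ∑ₖ ζ^{t k} = (d₂ − d₀) + (d₂ − d₁)ζ has squared modulus
-- Q = ((d₀ − d₁)² + (d₁ − d₂)² + (d₂ − d₀)²)/2, and 4Q = (2n − 3d_β)² + 3(d_β′ − d_β″)².
-- If e is bent, take x = −e: every row gives Q = n, and a codeword h + α within r of x
-- has d_{−α} ≤ r, so 2n − 3r ≤ 2n − 3d_{−α} ≤ 2√n.  If x is at distance ≥ r from every
-- codeword, all d_β ≥ r gives Q ≤ (2n − 3r)², while HᴴH = nI (which follows from HHᴴ = nI
-- since then ‖HᴴH − nI‖² = 0) and Parseval give ∑ᵢ |(Hx̄)ᵢ|² = n², so some row has Q ≥ n.
module Submission where

open import Defs
open import Data.Nat using (ℕ)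
open import Data.Fin using (Fin)
open import Data.Integer using (ℤ; +_; _-_; _*_; _≤_)
open import Data.Product using (_×_; ∃-syntax)
open import Data.Sum using (_⊎_)

open import Relation.Binary.PropositionalEquality
open import Algebra.Bundles using (CommutativeRing)
open import Algebra.Definitions {A = ℤζ} _≡_
  using (Associative; Commutative; LeftIdentity; LeftInverse; _DistributesOverˡ_)
open import Algebra.Structures {A = ℤζ} _≡_ using (IsCommutativeRing)
import Algebra.Properties.Monoid.Sum as MonoidSum
import Algebra.Properties.Ring as RingProperties
import Algebra.Properties.Semiring.Sum as SemiringSum
open import Data.Bool using (true; false; if_then_else_)
open import Data.Fin as Fin using (zero; suc)
open import Data.Fin.Patterns using (0F; 1F; 2F)
open import Data.Fin.Properties using (all?; any?)
open import Data.Integer as ℤ using (0ℤ; 1ℤ; _+_; _<_; +≤+)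
import Data.Integer.Properties as ℤₚ
open import Data.Integer.Tactic.RingSolver using (solve-∀)
open import Data.Maybe using (Maybe; just; nothing)
open import Data.Nat as ℕ using (zero; suc)
import Data.Nat.Properties as ℕₚ
import Data.Nat.Tactic.RingSolver as ℕ-Solver
open import Data.Product using (_,_; proj₁; proj₂)
open import Data.Sum using (inj₁; inj₂)
open import Function using (_∘_; flip)
open import Relation.Nullary using (does; yes; no; contradiction)
open import Relation.Nullary.Decidable using (from-yes)
import Tactic.RingSolver as ζ-Solver
import Tactic.RingSolver.Core.AlmostCommutativeRing as ACR

square-nonneg : ∀ x → 0ℤ ≤ x * x
square-nonneg (+ n) = subst (0ℤ ≤_) (ℤₚ.pos-* n n) (+≤+ ℕ.z≤n)
square-nonneg ℤ.-[1+ n ] = +≤+ ℕ.z≤n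

nonneg-+ : ∀ {x y} → 0ℤ ≤ x → 0ℤ ≤ y → 0ℤ ≤ x + y
nonneg-+ = ℤₚ.+-mono-≤

nonneg-* : ∀ {x y} → 0ℤ ≤ x → 0ℤ ≤ y → 0ℤ ≤ x * y
nonneg-* {+ a} {+ b} _ _ = subst (0ℤ ≤_) (ℤₚ.pos-* a b) (+≤+ ℕ.z≤n)

nonneg-+-≡0ˡ : ∀ {x y} → 0ℤ ≤ x → 0ℤ ≤ y → x + y ≡ 0ℤ → x ≡ 0ℤ
nonneg-+-≡0ˡ {+ a} (+≤+ _) (+≤+ _) eq = cong +_ (ℕₚ.m+n≡0⇒m≡0 a (ℤₚ.+-injective eq))

nonneg-+-≡0ʳ : ∀ {x y} → 0ℤ ≤ x → 0ℤ ≤ y → x + y ≡ 0ℤ → y ≡ 0ℤ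
nonneg-+-≡0ʳ {x} {y} 0≤x 0≤y eq = nonneg-+-≡0ˡ 0≤y 0≤x (trans (ℤₚ.+-comm y x) eq)

square≡0 : ∀ x → x * x ≡ 0ℤ → x ≡ 0ℤ
square≡0 x eq with ℤₚ.i*j≡0⇒i≡0∨j≡0 x eq
... | inj₁ x≡0 = x≡0
... | inj₂ x≡0 = x≡0

three-squares-nonneg : ∀ z → 0ℤ ≤ + 3 * (z * z)
three-squares-nonneg z = nonneg-* {+ 3} (+≤+ ℕ.z≤n) (square-nonneg z)

square-mono : ∀ {a b} → 0ℤ ≤ a → a ≤ b → a * a ≤ b * b
square-mono {a} {b} 0≤a a≤b = ℤₚ.≤-trans
  (ℤₚ.*-monoˡ-≤-nonNeg a {{ℤ.nonNegative 0≤a}} a≤b)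
  (ℤₚ.*-monoʳ-≤-nonNeg b {{ℤ.nonNegative (ℤₚ.≤-trans 0≤a a≤b)}} a≤b)

-- ℤ[ζ₃] as a commutative ring

+ζ-≡ : ∀ {a b c d} → a ≡ c → b ≡ d → (a + b ζ) ≡ (c + d ζ)
+ζ-≡ = cong₂ _+_ζ

infix 8 ⊟_
⊟_ : ℤζ → ℤζ
⊟ (a + b ζ) = (ℤ.- a) + (ℤ.- b) ζ

1ζ : ℤζ
1ζ = 1ℤ + 0ℤ ζ

⊞-assoc : Associative _⊞_
⊞-assoc (a + b ζ) (c + d ζ) (e + f ζ) = +ζ-≡ (ℤₚ.+-assoc a c e) (ℤₚ.+-assoc b d f)

⊞-comm : Commutative _⊞_
⊞-comm (a + b ζ) (c + d ζ) = +ζ-≡ (ℤₚ.+-comm a c) (ℤₚ.+-comm b d)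

⊞-identityˡ : LeftIdentity 0ζ _⊞_
⊞-identityˡ (a + b ζ) = +ζ-≡ (ℤₚ.+-identityˡ a) (ℤₚ.+-identityˡ b)

⊟-inverseˡ : LeftInverse 0ζ ⊟_ _⊞_
⊟-inverseˡ (a + b ζ) = +ζ-≡ (ℤₚ.+-inverseˡ a) (ℤₚ.+-inverseˡ b)

-- The integer ring solver does not unfold _⊠_, so the component identities are written out.
⊠-assoc : Associative _⊠_
⊠-assoc (a + b ζ) (c + d ζ) (e + f ζ) = +ζ-≡ (re-assoc a b c d e f) (im-assoc a b c d e f)
  where
  re-assoc : ∀ a b c d e f → (a * c - b * d) * e - (a * d + b * c - b * d) * f
                           ≡ a * (c * e - d * f) - b * (c * f + d * e - d * f)
  re-assoc = solve-∀
  im-assoc : ∀ a b c d e f → (a * c - b * d) * f + (a * d + b * c - b * d) * e - (a * d + b * c - b * d) * f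
                           ≡ a * (c * f + d * e - d * f) + b * (c * e - d * f) - b * (c * f + d * e - d * f)
  im-assoc = solve-∀

⊠-comm : Commutative _⊠_
⊠-comm (a + b ζ) (c + d ζ) = +ζ-≡ (re-comm a b c d) (im-comm a b c d)
  where
  re-comm : ∀ a b c d → a * c - b * d ≡ c * a - d * b
  re-comm = solve-∀
  im-comm : ∀ a b c d → a * d + b * c - b * d ≡ c * b + d * a - d * b
  im-comm = solve-∀

⊠-identityˡ : LeftIdentity 1ζ _⊠_
⊠-identityˡ (a + b ζ) = +ζ-≡ (re-identity a b) (im-identity a b)
  where
  re-identity : ∀ a b → 1ℤ * a - 0ℤ * b ≡ a
  re-identity = solve-∀
  im-identity : ∀ a b → 1ℤ * b + 0ℤ * a - 0ℤ * b ≡ b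
  im-identity = solve-∀

⊠-distribˡ-⊞ : _⊠_ DistributesOverˡ _⊞_
⊠-distribˡ-⊞ (a + b ζ) (c + d ζ) (e + f ζ) = +ζ-≡ (re-distrib a b c d e f) (im-distrib a b c d e f)
  where
  re-distrib : ∀ a b c d e f → a * (c + e) - b * (d + f) ≡ (a * c - b * d) + (a * e - b * f)
  re-distrib = solve-∀
  im-distrib : ∀ a b c d e f → a * (d + f) + b * (c + e) - b * (d + f)
                             ≡ (a * d + b * c - b * d) + (a * f + b * e - b * f)
  im-distrib = solve-∀

ℤζ-isCommutativeRing : IsCommutativeRing _⊞_ _⊠_ ⊟_ 0ζ 1ζ
ℤζ-isCommutativeRing = record
  { isRing = record
    { +-isAbelianGroup = record
      { isGroup = record
        { isMonoid = record
          { isSemigroup = record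
            { isMagma = record { isEquivalence = isEquivalence ; ∙-cong = cong₂ _⊞_ }
            ; assoc = ⊞-assoc }
          ; identity = ⊞-identityˡ , λ x → trans (⊞-comm x 0ζ) (⊞-identityˡ x) }
        ; inverse = ⊟-inverseˡ , λ x → trans (⊞-comm x (⊟ x)) (⊟-inverseˡ x)
        ; ⁻¹-cong = cong ⊟_ }
      ; comm = ⊞-comm }
    ; *-cong = cong₂ _⊠_
    ; *-assoc = ⊠-assoc
    ; *-identity = ⊠-identityˡ , λ x → trans (⊠-comm x 1ζ) (⊠-identityˡ x)
    ; distrib = ⊠-distribˡ-⊞ , λ x y z → trans (⊠-comm (y ⊞ z) x)
                  (trans (⊠-distribˡ-⊞ x y z) (cong₂ _⊞_ (⊠-comm x y) (⊠-comm x z))) }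
  ; *-comm = ⊠-comm }

ℤζ-commutativeRing : CommutativeRing _ _
ℤζ-commutativeRing = record { isCommutativeRing = ℤζ-isCommutativeRing }

ℤζ-ring : ACR.AlmostCommutativeRing _ _
ℤζ-ring = ACR.fromCommutativeRing ℤζ-commutativeRing 0ζ≟
  where
  -- the solver only cancels monomials whose coefficient it recognises as zero
  0ζ≟ : ∀ x → Maybe (0ζ ≡ x)
  0ζ≟ ((+ 0) + (+ 0) ζ) = just refl
  0ζ≟ _ = nothing

open CommutativeRing ℤζ-commutativeRing
  using (+-identityˡ; +-identityʳ; zeroˡ; distribˡ; semiring; ring)
open RingProperties ring using (+-identityˡ-unique; x∙y⁻¹≈ε⇒x≈y)

conj-involutive : ∀ x → conj (conj x) ≡ x
conj-involutive (a + b ζ) = +ζ-≡ (re-involutive a b) (ℤₚ.neg-involutive b)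
  where
  re-involutive : ∀ a b → a - b - ℤ.- b ≡ a
  re-involutive = solve-∀

conj-⊞ : ∀ x y → conj (x ⊞ y) ≡ conj x ⊞ conj y
conj-⊞ (a + b ζ) (c + d ζ) = +ζ-≡ (re-⊞ a b c d) (ℤₚ.neg-distrib-+ b d)
  where
  re-⊞ : ∀ a b c d → (a + c) - (b + d) ≡ (a - b) + (c - d)
  re-⊞ = solve-∀

conj-⊠ : ∀ x y → conj (x ⊠ y) ≡ conj x ⊠ conj y
conj-⊠ (a + b ζ) (c + d ζ) = +ζ-≡ (re-⊠ a b c d) (im-⊠ a b c d)
  where
  re-⊠ : ∀ a b c d → (a * c - b * d) - (a * d + b * c - b * d) ≡ (a - b) * (c - d) - ℤ.- b * ℤ.- d
  re-⊠ = solve-∀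
  im-⊠ : ∀ a b c d → ℤ.- (a * d + b * c - b * d) ≡ (a - b) * ℤ.- d + ℤ.- b * (c - d) - ℤ.- b * ℤ.- d
  im-⊠ = solve-∀

conj-⊟ : ∀ x → conj (⊟ x) ≡ ⊟ conj x
conj-⊟ (a + b ζ) = +ζ-≡ (re-⊟ a b) refl
  where
  re-⊟ : ∀ a b → ℤ.- a - ℤ.- b ≡ ℤ.- (a - b)
  re-⊟ = solve-∀

conj-embℕ : ∀ m → conj (embℕ m) ≡ embℕ m
conj-embℕ m = +ζ-≡ (ℤₚ.+-identityʳ (+ m)) refl

embℕ-⊠ : ∀ a b → embℕ a ⊠ embℕ b ≡ embℕ (a ℕ.* b)
embℕ-⊠ a b = +ζ-≡ (trans (ℤₚ.+-identityʳ _) (sym (ℤₚ.pos-* a b))) (im-⊠ (+ a) (+ b))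
  where
  im-⊠ : ∀ x y → x * 0ℤ + 0ℤ * y - 0ℤ * 0ℤ ≡ 0ℤ
  im-⊠ = solve-∀

⊠-conj : ∀ x → x ⊠ conj x ≡ normSq x + 0ℤ ζ
⊠-conj (a + b ζ) = +ζ-≡ (re-norm a b) (im-norm a b)
  where
  re-norm : ∀ a b → a * (a - b) - b * ℤ.- b ≡ a * a - a * b + b * b
  re-norm = solve-∀
  im-norm : ∀ a b → a * ℤ.- b + b * (a - b) - b * ℤ.- b ≡ 0ℤ
  im-norm = solve-∀

four-normSq : ∀ a b → + 4 * (a * a - a * b + b * b) ≡ (+ 2 * a - b) * (+ 2 * a - b) + + 3 * (b * b)
four-normSq = solve-∀

normSq-nonneg : ∀ x → 0ℤ ≤ normSq x
normSq-nonneg (a + b ζ) = ℤₚ.*-cancelˡ-≤-pos 0ℤ _ (+ 4) (subst (0ℤ ≤_) (sym (four-normSq a b))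
  (nonneg-+ (square-nonneg (+ 2 * a - b)) (three-squares-nonneg b)))

normSq≡0⇒im≡0 : ∀ a b → normSq (a + b ζ) ≡ 0ℤ → b ≡ 0ℤ
normSq≡0⇒im≡0 a b N≡0 = square≡0 b (ℤₚ.*-cancelˡ-≡ (+ 3) (b * b) 0ℤ three-b²≡0)
  where
  three-b²≡0 : + 3 * (b * b) ≡ 0ℤ
  three-b²≡0 = nonneg-+-≡0ʳ (square-nonneg (+ 2 * a - b)) (three-squares-nonneg b)
                 (trans (sym (four-normSq a b)) (cong (+ 4 *_) N≡0))

normSq≡0⇒≡0ζ : ∀ x → normSq x ≡ 0ℤ → x ≡ 0ζ
normSq≡0⇒≡0ζ (a + b ζ) N≡0 =
  +ζ-≡ (normSq≡0⇒im≡0 b a (trans (normSq-swap a b) N≡0)) (normSq≡0⇒im≡0 a b N≡0)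
  where
  normSq-swap : ∀ a b → b * b - b * a + a * a ≡ a * a - a * b + b * b
  normSq-swap = solve-∀

-- Finite sums and Gram matrices

open SemiringSum semiring
  using (sum; sum-cong-≗; ∑-comm; ∑-distrib-+; *-distribˡ-sum; *-distribʳ-sum)
module ℤΣ = MonoidSum ℤₚ.+-0-monoid

Σζ≡sum : ∀ {n} (f : Fin n → ℤζ) → Σζ f ≡ sum f
Σζ≡sum {zero} f = refl
Σζ≡sum {suc n} f = cong (f zero ⊞_) (Σζ≡sum (f ∘ suc))

conj-sum : ∀ {n} (f : Fin n → ℤζ) → conj (sum f) ≡ sum (conj ∘ f)
conj-sum {zero} f = refl
conj-sum {suc n} f = trans (conj-⊞ (f zero) _) (cong (conj (f zero) ⊞_) (conj-sum (f ∘ suc)))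

re-sum : ∀ {n} (f : Fin n → ℤζ) → re (sum f) ≡ ℤΣ.sum (re ∘ f)
re-sum {zero} f = refl
re-sum {suc n} f = cong (ℤ._+_ (re (f zero))) (re-sum (f ∘ suc))

∑-⊠-∑ : ∀ {m n} (f : Fin m → ℤζ) (g : Fin n → ℤζ) →
        sum f ⊠ sum g ≡ sum (λ i → sum (λ j → f i ⊠ g j))
∑-⊠-∑ f g = trans (*-distribʳ-sum (sum g) f) (sum-cong-≗ λ i → *-distribˡ-sum (f i) g)

∑∑-distrib-⊞ : ∀ {m n} (F G : Fin m → Fin n → ℤζ) →
               sum (λ i → sum (λ j → F i j ⊞ G i j)) ≡ sum (λ i → sum (F i)) ⊞ sum (λ i → sum (G i))
∑∑-distrib-⊞ F G = trans (sum-cong-≗ λ i → ∑-distrib-+ (F i) (G i))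
                         (∑-distrib-+ (λ i → sum (F i)) (λ i → sum (G i)))

⊠-exchange : ∀ a b c d → (a ⊠ b) ⊠ (c ⊠ d) ≡ (a ⊠ d) ⊠ (c ⊠ b)
⊠-exchange = ζ-Solver.solve-∀ ℤζ-ring

infix 4 ⟪_,_⟫
⟪_,_⟫ : ∀ {n} → (Fin n → ℤζ) → (Fin n → ℤζ) → ℤζ
⟪ u , v ⟫ = sum (λ k → u k ⊠ conj (v k))

conj-⟪⟫ : ∀ {n} (u v : Fin n → ℤζ) → conj ⟪ u , v ⟫ ≡ ⟪ v , u ⟫
conj-⟪⟫ u v = trans (conj-sum (λ k → u k ⊠ conj (v k))) (sum-cong-≗ λ k → begin
  conj (u k ⊠ conj (v k))        ≡⟨ conj-⊠ (u k) (conj (v k)) ⟩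
  conj (u k) ⊠ conj (conj (v k)) ≡⟨ cong (conj (u k) ⊠_) (conj-involutive (v k)) ⟩
  conj (u k) ⊠ v k               ≡⟨ ⊠-comm (conj (u k)) (v k) ⟩
  v k ⊠ conj (u k)               ∎)
  where open ≡-Reasoning

re-⟪⟫ : ∀ {n} (u : Fin n → ℤζ) → re ⟪ u , u ⟫ ≡ ℤΣ.sum (normSq ∘ u)
re-⟪⟫ u = trans (re-sum (λ k → u k ⊠ conj (u k))) (ℤΣ.sum-cong-≗ λ k → cong re (⊠-conj (u k)))

Matrix : ℕ → ℕ → Set
Matrix m n = Fin m → Fin n → ℤζ

gram : ∀ {m n} → Matrix m n → Matrix m m
gram A i j = ⟪ A i , A j ⟫

trace : ∀ {n} → Matrix n n → ℤζ
trace M = sum (λ k → M k k)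

_·_ : ∀ {m n p} → Matrix m n → Matrix n p → Matrix m p
(M · N) i j = sum (λ k → M i k ⊠ N k j)

-- c times the identity; nδ n of the definitions is δ (embℕ n)
δ : ∀ {n} → ℤζ → Matrix n n
δ c i j = if does (i Fin.≟ j) then c else 0ζ

conj-δ : ∀ {n} c → conj c ≡ c → (i j : Fin n) → conj (δ c i j) ≡ δ c i j
conj-δ c conj-c i j with does (i Fin.≟ j)
... | true = conj-c
... | false = refl

∑-δ : ∀ {n} c (k : Fin n) (f : Fin n → ℤζ) → sum (λ l → δ c k l ⊠ f l) ≡ c ⊠ f k
∑-δ c zero f =
  trans (cong (c ⊠ f zero ⊞_) (trans (sym (*-distribˡ-sum 0ζ (f ∘ suc))) (zeroˡ (sum (f ∘ suc)))))
        (+-identityʳ (c ⊠ f zero))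
∑-δ c (suc k) f = trans (cong₂ _⊞_ (zeroˡ (f zero)) (∑-δ c k (f ∘ suc))) (+-identityˡ _)

∑∑-δ : ∀ {n} c (F : Matrix n n) → sum (λ k → sum (λ l → δ c k l ⊠ F k l)) ≡ c ⊠ trace F
∑∑-δ c F = trans (sum-cong-≗ λ k → ∑-δ c k (F k)) (sym (*-distribˡ-sum c (λ k → F k k)))

∑∑∑∑-comm : ∀ {a b c d} (F : Fin a → Fin b → Fin c → Fin d → ℤζ) →
            sum (λ k → sum (λ l → sum (λ i → sum (λ j → F k l i j))))
            ≡ sum (λ i → sum (λ j → sum (λ k → sum (λ l → F k l i j))))
∑∑∑∑-comm F = begin
  sum (λ k → sum (λ l → sum (λ i → sum (λ j → F k l i j))))
    ≡⟨ sum-cong-≗ (λ k → ∑-comm (λ l i → sum (F k l i))) ⟩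
  sum (λ k → sum (λ i → sum (λ l → sum (λ j → F k l i j))))
    ≡⟨ ∑-comm (λ k i → sum (λ l → sum (F k l i))) ⟩
  sum (λ i → sum (λ k → sum (λ l → sum (λ j → F k l i j))))
    ≡⟨ sum-cong-≗ (λ i → sum-cong-≗ (λ k → ∑-comm (λ l j → F k l i j))) ⟩
  sum (λ i → sum (λ k → sum (λ j → sum (λ l → F k l i j))))
    ≡⟨ sum-cong-≗ (λ i → ∑-comm (λ k j → sum (λ l → F k l i j))) ⟩
  sum (λ i → sum (λ j → sum (λ k → sum (λ l → F k l i j)))) ∎
  where open ≡-Reasoning

trace-gram-flip : ∀ {m n} (A : Matrix m n) → trace (gram (flip A)) ≡ trace (gram A)
trace-gram-flip A = ∑-comm (λ k i → A i k ⊠ conj (A i k))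

trace-gram²-flip : ∀ {m n} (A : Matrix m n) →
                   trace (gram (flip A) · gram (flip A)) ≡ trace (gram A · gram A)
trace-gram²-flip A = begin
  sum (λ k → sum (λ l → ⟪ flip A k , flip A l ⟫ ⊠ ⟪ flip A l , flip A k ⟫))
    ≡⟨ sum-cong-≗ (λ k → sum-cong-≗ λ l →
         ∑-⊠-∑ (λ i → A i k ⊠ conj (A i l)) (λ j → A j l ⊠ conj (A j k))) ⟩
  sum (λ k → sum (λ l → sum (λ i → sum (λ j → (A i k ⊠ conj (A i l)) ⊠ (A j l ⊠ conj (A j k))))))
    ≡⟨ ∑∑∑∑-comm (λ k l i j → (A i k ⊠ conj (A i l)) ⊠ (A j l ⊠ conj (A j k))) ⟩
  sum (λ i → sum (λ j → sum (λ k → sum (λ l → (A i k ⊠ conj (A i l)) ⊠ (A j l ⊠ conj (A j k))))))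
    ≡⟨ sum-cong-≗ (λ i → sum-cong-≗ λ j → sum-cong-≗ λ k → sum-cong-≗ λ l →
         ⊠-exchange (A i k) (conj (A i l)) (A j l) (conj (A j k))) ⟩
  sum (λ i → sum (λ j → sum (λ k → sum (λ l → (A i k ⊠ conj (A j k)) ⊠ (A j l ⊠ conj (A i l))))))
    ≡⟨ sum-cong-≗ (λ i → sum-cong-≗ λ j →
         ∑-⊠-∑ (λ k → A i k ⊠ conj (A j k)) (λ l → A j l ⊠ conj (A i l))) ⟨
  sum (λ i → sum (λ j → ⟪ A i , A j ⟫ ⊠ ⟪ A j , A i ⟫)) ∎
  where open ≡-Reasoning

-- For Hermitian M and real c, ‖M − cI‖² = tr(M²) − 2c·tr M + c·tr(cI), kept free of subtraction.
hermitian-distance-to-scalar : ∀ {n} (M : Matrix n n) c → conj c ≡ c → (∀ k l → conj (M k l) ≡ M l k) →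
  sum (λ k → ⟪ (λ l → M k l ⊞ ⊟ δ c k l) , (λ l → M k l ⊞ ⊟ δ c k l) ⟫) ⊞ c ⊠ (trace M ⊞ trace M)
  ≡ trace (M · M) ⊞ c ⊠ trace (δ {n} c)
hermitian-distance-to-scalar {n} M c conj-c hermitian = begin
  sum (λ k → sum (λ l → D k l ⊠ conj (D k l))) ⊞ c ⊠ (trace M ⊞ trace M)
    ≡⟨ cong (sum (λ k → sum (λ l → D k l ⊠ conj (D k l))) ⊞_) cross-terms ⟨
  sum (λ k → sum (λ l → D k l ⊠ conj (D k l))) ⊞ sum (λ k → sum (λ l → δ c k l ⊠ (M l k ⊞ M k l)))
    ≡⟨ ∑∑-distrib-⊞ (λ k l → D k l ⊠ conj (D k l)) (λ k l → δ c k l ⊠ (M l k ⊞ M k l)) ⟨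
  sum (λ k → sum (λ l → D k l ⊠ conj (D k l) ⊞ δ c k l ⊠ (M l k ⊞ M k l)))
    ≡⟨ sum-cong-≗ (λ k → sum-cong-≗ λ l → pointwise k l) ⟩
  sum (λ k → sum (λ l → M k l ⊠ M l k ⊞ δ c k l ⊠ δ c k l))
    ≡⟨ ∑∑-distrib-⊞ (λ k l → M k l ⊠ M l k) (λ k l → δ {n} c k l ⊠ δ c k l) ⟩
  trace (M · M) ⊞ sum (λ k → sum (λ l → δ {n} c k l ⊠ δ c k l))
    ≡⟨ cong (trace (M · M) ⊞_) (∑∑-δ c (δ {n} c)) ⟩
  trace (M · M) ⊞ c ⊠ trace (δ {n} c) ∎
  where
  open ≡-Reasoning
  D : Matrix n n
  D k l = M k l ⊞ ⊟ δ c k l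
  cross-terms : sum (λ k → sum (λ l → δ c k l ⊠ (M l k ⊞ M k l))) ≡ c ⊠ (trace M ⊞ trace M)
  cross-terms = trans (∑∑-δ c (λ k l → M l k ⊞ M k l))
                      (cong (c ⊠_) (∑-distrib-+ (λ k → M k k) (λ k → M k k)))
  expand : ∀ x y d → (x ⊞ ⊟ d) ⊠ (y ⊞ ⊟ d) ⊞ d ⊠ (y ⊞ x) ≡ x ⊠ y ⊞ d ⊠ d
  expand = ζ-Solver.solve-∀ ℤζ-ring
  pointwise : ∀ k l → D k l ⊠ conj (D k l) ⊞ δ c k l ⊠ (M l k ⊞ M k l) ≡ M k l ⊠ M l k ⊞ δ c k l ⊠ δ c k l
  pointwise k l = begin
    D k l ⊠ conj (D k l) ⊞ δ c k l ⊠ (M l k ⊞ M k l)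
      ≡⟨ cong (λ z → D k l ⊠ z ⊞ δ c k l ⊠ (M l k ⊞ M k l)) conj-D ⟩
    D k l ⊠ (M l k ⊞ ⊟ δ c k l) ⊞ δ c k l ⊠ (M l k ⊞ M k l)
      ≡⟨ expand (M k l) (M l k) (δ c k l) ⟩
    M k l ⊠ M l k ⊞ δ c k l ⊠ δ c k l ∎
    where
    conj-D : conj (D k l) ≡ M l k ⊞ ⊟ δ c k l
    conj-D = trans (conj-⊞ (M k l) (⊟ δ c k l))
                   (cong₂ _⊞_ (hermitian k l) (trans (conj-⊟ (δ c k l)) (cong ⊟_ (conj-δ c conj-c k l))))

sum-nonneg : ∀ {n} (f : Fin n → ℤ) → (∀ i → 0ℤ ≤ f i) → 0ℤ ≤ ℤΣ.sum f
sum-nonneg {zero} f _ = +≤+ ℕ.z≤n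
sum-nonneg {suc n} f 0≤f = nonneg-+ (0≤f zero) (sum-nonneg (f ∘ suc) (0≤f ∘ suc))

sum-nonneg-≡0 : ∀ {n} (f : Fin n → ℤ) → (∀ i → 0ℤ ≤ f i) → ℤΣ.sum f ≡ 0ℤ → ∀ i → f i ≡ 0ℤ
sum-nonneg-≡0 f 0≤f Σ≡0 zero = nonneg-+-≡0ˡ (0≤f zero) (sum-nonneg (f ∘ suc) (0≤f ∘ suc)) Σ≡0
sum-nonneg-≡0 f 0≤f Σ≡0 (suc i) =
  sum-nonneg-≡0 (f ∘ suc) (0≤f ∘ suc) (nonneg-+-≡0ʳ (0≤f zero) (sum-nonneg (f ∘ suc) (0≤f ∘ suc)) Σ≡0) i

sum-≤ : ∀ {n} (f : Fin n → ℤ) c → (∀ i → f i ≤ + c) → ℤΣ.sum f ≤ + (n ℕ.* c)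
sum-≤ {zero} f c _ = +≤+ ℕ.z≤n
sum-≤ {suc n} f c f≤c = ℤₚ.+-mono-≤ (f≤c zero) (sum-≤ (f ∘ suc) c (f≤c ∘ suc))

pigeonhole : ∀ {n} (f : Fin (suc n) → ℤ) c → + (suc n ℕ.* c) ≤ ℤΣ.sum f → ∃[ i ] + c ≤ f i
pigeonhole f c total with any? (λ i → + c ℤₚ.≤? f i)
... | yes found = found
... | no none = contradiction total
      (ℤₚ.<⇒≱ (ℤₚ.+-mono-<-≤ (below zero) (sum-≤ (f ∘ suc) c (ℤₚ.<⇒≤ ∘ below ∘ suc))))
  where
  below : ∀ i → f i < + c
  below i = ℤₚ.≰⇒> (λ c≤fi → none (i , c≤fi))

∑⟪⟫≡0ζ⇒≡0ζ : ∀ {m n} (D : Matrix m n) → sum (λ k → ⟪ D k , D k ⟫) ≡ 0ζ → ∀ k l → D k l ≡ 0ζ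
∑⟪⟫≡0ζ⇒≡0ζ D Σ≡0 k l = normSq≡0⇒≡0ζ (D k l)
  (sum-nonneg-≡0 (normSq ∘ D k) (normSq-nonneg ∘ D k)
    (trans (sym (re-⟪⟫ (D k))) (sum-nonneg-≡0 (λ k → re ⟪ D k , D k ⟫) re-⟪⟫-nonneg re-Σ≡0 k))
    l)
  where
  re-Σ≡0 : ℤΣ.sum (λ k → re ⟪ D k , D k ⟫) ≡ 0ℤ
  re-Σ≡0 = trans (sym (re-sum (λ k → ⟪ D k , D k ⟫))) (cong re Σ≡0)
  re-⟪⟫-nonneg : ∀ k → 0ℤ ≤ re ⟪ D k , D k ⟫
  re-⟪⟫-nonneg k = subst (0ℤ ≤_) (sym (re-⟪⟫ (D k))) (sum-nonneg (normSq ∘ D k) (normSq-nonneg ∘ D k))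

-- If AAᴴ = cI then ‖AᴴA − cI‖² = tr((AᴴA)²) − 2c·tr(AᴴA) + c²n = tr((AAᴴ)²) − 2c·tr(AAᴴ) + c²n = 0.
rows⇒columns : ∀ {n} (A : Matrix n n) c → conj c ≡ c →
               (∀ i j → gram A i j ≡ δ c i j) → ∀ k l → gram (flip A) k l ≡ δ c k l
rows⇒columns {n} A c conj-c rows k l = x∙y⁻¹≈ε⇒x≈y (G k l) (δ c k l) (∑⟪⟫≡0ζ⇒≡0ζ D distance≡0 k l)
  where
  open ≡-Reasoning
  G = gram (flip A)
  T = trace (δ {n} c)
  D : Matrix n n
  D k l = G k l ⊞ ⊟ δ c k l
  trace-G : trace G ≡ T
  trace-G = trans (trace-gram-flip A) (sum-cong-≗ λ i → rows i i)
  trace-G² : trace (G · G) ≡ c ⊠ T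
  trace-G² = begin
    trace (G · G)             ≡⟨ trace-gram²-flip A ⟩
    trace (gram A · gram A)   ≡⟨ sum-cong-≗ (λ i → sum-cong-≗ λ j → cong₂ _⊠_ (rows i j) (rows j i)) ⟩
    trace (δ {n} c · δ c)     ≡⟨ ∑∑-δ c (flip (δ {n} c)) ⟩
    c ⊠ T                     ∎
  distance≡0 : sum (λ k → ⟪ D k , D k ⟫) ≡ 0ζ
  distance≡0 = +-identityˡ-unique _ (c ⊠ (T ⊞ T)) (begin
    sum (λ k → ⟪ D k , D k ⟫) ⊞ c ⊠ (T ⊞ T)
      ≡⟨ cong (λ t → sum (λ k → ⟪ D k , D k ⟫) ⊞ c ⊠ (t ⊞ t)) trace-G ⟨
    sum (λ k → ⟪ D k , D k ⟫) ⊞ c ⊠ (trace G ⊞ trace G)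
      ≡⟨ hermitian-distance-to-scalar G c conj-c (λ k l → conj-⟪⟫ (flip A k) (flip A l)) ⟩
    trace (G · G) ⊞ c ⊠ T
      ≡⟨ cong (_⊞ c ⊠ T) trace-G² ⟩
    c ⊠ T ⊞ c ⊠ T
      ≡⟨ distribˡ c T T ⟨
    c ⊠ (T ⊞ T) ∎)

parseval : ∀ {m n} (A : Matrix m n) c → (∀ k l → gram (flip A) k l ≡ δ c k l) →
           ∀ u → ⟪ (λ i → ⟪ A i , u ⟫) , (λ i → ⟪ A i , u ⟫) ⟫ ≡ c ⊠ ⟪ u , u ⟫
parseval A c columns u = begin
  sum (λ i → ⟪ A i , u ⟫ ⊠ conj ⟪ A i , u ⟫)
    ≡⟨ sum-cong-≗ (λ i → trans (cong (⟪ A i , u ⟫ ⊠_) (conj-⟪⟫ (A i) u))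
                               (∑-⊠-∑ (λ k → A i k ⊠ conj (u k)) (λ l → u l ⊠ conj (A i l)))) ⟩
  sum (λ i → sum (λ k → sum (λ l → (A i k ⊠ conj (u k)) ⊠ (u l ⊠ conj (A i l)))))
    ≡⟨ ∑-comm (λ i k → sum (λ l → (A i k ⊠ conj (u k)) ⊠ (u l ⊠ conj (A i l)))) ⟩
  sum (λ k → sum (λ i → sum (λ l → (A i k ⊠ conj (u k)) ⊠ (u l ⊠ conj (A i l)))))
    ≡⟨ sum-cong-≗ (λ k → ∑-comm (λ i l → (A i k ⊠ conj (u k)) ⊠ (u l ⊠ conj (A i l)))) ⟩
  sum (λ k → sum (λ l → sum (λ i → (A i k ⊠ conj (u k)) ⊠ (u l ⊠ conj (A i l)))))
    ≡⟨ sum-cong-≗ (λ k → sum-cong-≗ λ l → sum-cong-≗ λ i →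
         ⊠-exchange (A i k) (conj (u k)) (u l) (conj (A i l))) ⟩
  sum (λ k → sum (λ l → sum (λ i → (A i k ⊠ conj (A i l)) ⊠ (u l ⊠ conj (u k)))))
    ≡⟨ sum-cong-≗ (λ k → sum-cong-≗ λ l →
         trans (sym (*-distribʳ-sum (u l ⊠ conj (u k)) (λ i → A i k ⊠ conj (A i l))))
               (cong (_⊠ (u l ⊠ conj (u k))) (columns k l))) ⟩
  sum (λ k → sum (λ l → δ c k l ⊠ (u l ⊠ conj (u k))))
    ≡⟨ ∑∑-δ c (λ k l → u l ⊠ conj (u k)) ⟩
  c ⊠ ⟪ u , u ⟫ ∎
  where open ≡-Reasoning

-- Words over ℤ₃

neg : Fin 3 → Fin 3
neg 0F = 0F
neg 1F = 2F
neg 2F = 1F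

infixl 6 _⊖_
_⊖_ : Fin 3 → Fin 3 → Fin 3
a ⊖ b = a ⊕ neg b

neg-involutive : ∀ a → neg (neg a) ≡ a
neg-involutive 0F = refl
neg-involutive 1F = refl
neg-involutive 2F = refl

ζ^-⊕ : ∀ a b → ζ^ a ⊠ ζ^ b ≡ ζ^ (a ⊕ b)
ζ^-⊕ 0F 0F = refl
ζ^-⊕ 0F 1F = refl
ζ^-⊕ 0F 2F = refl
ζ^-⊕ 1F 0F = refl
ζ^-⊕ 1F 1F = refl
ζ^-⊕ 1F 2F = refl
ζ^-⊕ 2F 0F = refl
ζ^-⊕ 2F 1F = refl
ζ^-⊕ 2F 2F = refl

conj-ζ^ : ∀ a → conj (ζ^ a) ≡ ζ^ (neg a)
conj-ζ^ 0F = refl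
conj-ζ^ 1F = refl
conj-ζ^ 2F = refl

ζ^-⊖ : ∀ a b → ζ^ a ⊠ conj (ζ^ b) ≡ ζ^ (a ⊖ b)
ζ^-⊖ a b = trans (cong (ζ^ a ⊠_) (conj-ζ^ b)) (ζ^-⊕ a (neg b))

∑-ζ^⊠conj-ζ^ : ∀ {n} (x : Fin n → Fin 3) → ⟪ ζ^ ∘ x , ζ^ ∘ x ⟫ ≡ embℕ n
∑-ζ^⊠conj-ζ^ {zero} x = refl
∑-ζ^⊠conj-ζ^ {suc n} x =
  cong₂ _⊞_ (trans (ζ^-⊖ (x zero) (x zero)) (ζ^-0 (x zero))) (∑-ζ^⊠conj-ζ^ (x ∘ suc))
  where
  ζ^-0 : ∀ a → ζ^ (a ⊖ a) ≡ 1ζ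
  ζ^-0 0F = refl
  ζ^-0 1F = refl
  ζ^-0 2F = refl

dist : ∀ {n} → (Fin n → Fin 3) → Fin 3 → ℕ
dist t β = hamming t (λ _ → β)

dec≡-codeword : ∀ x a α → dec≡ x (a ⊕ α) ≡ dec≡ (a ⊖ x) (neg α)
dec≡-codeword = from-yes (all? λ x → all? λ a → all? λ α → dec≡ x (a ⊕ α) ℕ.≟ dec≡ (a ⊖ x) (neg α))

hamming-codeword : ∀ {n} (x a : Fin n → Fin 3) α →
                   hamming x (λ k → a k ⊕ α) ≡ dist (λ k → a k ⊖ x k) (neg α)
hamming-codeword {zero} x a α = refl
hamming-codeword {suc n} x a α =
  cong₂ ℕ._+_ (dec≡-codeword (x zero) (a zero) α) (hamming-codeword (x ∘ suc) (a ∘ suc) α)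

dist-sum : ∀ {n} (t : Fin n → Fin 3) → dist t 0F ℕ.+ dist t 1F ℕ.+ dist t 2F ≡ 2 ℕ.* n
dist-sum {zero} t = refl
dist-sum {suc n} t = begin
  (dec≡ (t 0F) 0F ℕ.+ dist (t ∘ suc) 0F) ℕ.+ (dec≡ (t 0F) 1F ℕ.+ dist (t ∘ suc) 1F)
    ℕ.+ (dec≡ (t 0F) 2F ℕ.+ dist (t ∘ suc) 2F)
    ≡⟨ regroup (dec≡ (t 0F) 0F) (dec≡ (t 0F) 1F) (dec≡ (t 0F) 2F) _ _ _ ⟩
  (dec≡ (t 0F) 0F ℕ.+ dec≡ (t 0F) 1F ℕ.+ dec≡ (t 0F) 2F)
    ℕ.+ (dist (t ∘ suc) 0F ℕ.+ dist (t ∘ suc) 1F ℕ.+ dist (t ∘ suc) 2F)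
    ≡⟨ cong₂ ℕ._+_ (dec≡-sum (t 0F)) (dist-sum (t ∘ suc)) ⟩
  2 ℕ.+ 2 ℕ.* n
    ≡⟨ ℕₚ.*-suc 2 n ⟨
  2 ℕ.* suc n ∎
  where
  open ≡-Reasoning
  regroup : ∀ a b c x y z → (a ℕ.+ x) ℕ.+ (b ℕ.+ y) ℕ.+ (c ℕ.+ z) ≡ (a ℕ.+ b ℕ.+ c) ℕ.+ (x ℕ.+ y ℕ.+ z)
  regroup = ℕ-Solver.solve-∀
  dec≡-sum : ∀ a → dec≡ a 0F ℕ.+ dec≡ a 1F ℕ.+ dec≡ a 2F ≡ 2
  dec≡-sum 0F = refl
  dec≡-sum 1F = refl
  dec≡-sum 2F = refl

sub-+-sub : ∀ u v c a → (u - v) + (c - a) ≡ (u + c) - (v + a)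
sub-+-sub = solve-∀

ζ^-⊞-step : ∀ a d₀ d₁ d₂ →
  ζ^ a ⊞ ((+ d₂ - + d₀) + (+ d₂ - + d₁) ζ)
  ≡ (+ (dec≡ a 2F ℕ.+ d₂) - + (dec≡ a 0F ℕ.+ d₀)) + (+ (dec≡ a 2F ℕ.+ d₂) - + (dec≡ a 1F ℕ.+ d₁)) ζ
ζ^-⊞-step 0F d₀ d₁ d₂ = +ζ-≡ (sub-+-sub 1ℤ 0ℤ (+ d₂) (+ d₀)) (sub-+-sub 1ℤ 1ℤ (+ d₂) (+ d₁))
ζ^-⊞-step 1F d₀ d₁ d₂ = +ζ-≡ (sub-+-sub 1ℤ 1ℤ (+ d₂) (+ d₀)) (sub-+-sub 1ℤ 0ℤ (+ d₂) (+ d₁))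
ζ^-⊞-step 2F d₀ d₁ d₂ = +ζ-≡ (sub-+-sub 0ℤ 1ℤ (+ d₂) (+ d₀)) (sub-+-sub 0ℤ 1ℤ (+ d₂) (+ d₁))

-- ∑ₖ ζ^(t k) = ∑_β (n − dist t β) ζ^β = −∑_β (dist t β) ζ^β, as 1 + ζ + ζ² = 0.
∑-ζ^ : ∀ {n} (t : Fin n → Fin 3) →
       sum (ζ^ ∘ t) ≡ (+ dist t 2F - + dist t 0F) + (+ dist t 2F - + dist t 1F) ζ
∑-ζ^ {zero} t = refl
∑-ζ^ {suc n} t = trans (cong (ζ^ (t 0F) ⊞_) (∑-ζ^ (t ∘ suc)))
  (ζ^-⊞-step (t 0F) (dist (t ∘ suc) 0F) (dist (t ∘ suc) 1F) (dist (t ∘ suc) 2F))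

-- The norm form in terms of the three distances

-- ((a − b)² + (b − c)² + (c − a)²)/2, the squared modulus of a + bζ + cζ²
Q : ℤ → ℤ → ℤ → ℤ
Q a b c = a * a + b * b + c * c - a * b - b * c - c * a

normSq-Q : ∀ a b c → normSq ((c - a) + (c - b) ζ) ≡ Q a b c
normSq-Q = expanded
  where
  expanded : ∀ a b c → (c - a) * (c - a) - (c - a) * (c - b) + (c - b) * (c - b)
                     ≡ a * a + b * b + c * c - a * b - b * c - c * a
  expanded = solve-∀

≤-+-three-squares : ∀ {x y} z → y ≡ x + + 3 * (z * z) → x ≤ y
≤-+-three-squares {x} z y≡ = subst (x ≤_) (sym y≡)
  (ℤₚ.i≤i+j x _ {{ℤ.nonNegative (three-squares-nonneg z)}})

square≤four-Q : ∀ (d : Fin 3 → ℤ) β →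
  (d 0F + d 1F + d 2F - + 3 * d β) * (d 0F + d 1F + d 2F - + 3 * d β) ≤ + 4 * Q (d 0F) (d 1F) (d 2F)
square≤four-Q d 0F = ≤-+-three-squares (d 1F - d 2F) (split₀ (d 0F) (d 1F) (d 2F))
  where
  split₀ : ∀ a b c → + 4 * (a * a + b * b + c * c - a * b - b * c - c * a)
                   ≡ (a + b + c - + 3 * a) * (a + b + c - + 3 * a) + + 3 * ((b - c) * (b - c))
  split₀ = solve-∀
square≤four-Q d 1F = ≤-+-three-squares (d 2F - d 0F) (split₁ (d 0F) (d 1F) (d 2F))
  where
  split₁ : ∀ a b c → + 4 * (a * a + b * b + c * c - a * b - b * c - c * a)
                   ≡ (a + b + c - + 3 * b) * (a + b + c - + 3 * b) + + 3 * ((c - a) * (c - a))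
  split₁ = solve-∀
square≤four-Q d 2F = ≤-+-three-squares (d 0F - d 1F) (split₂ (d 0F) (d 1F) (d 2F))
  where
  split₂ : ∀ a b c → + 4 * (a * a + b * b + c * c - a * b - b * c - c * a)
                   ≡ (a + b + c - + 3 * c) * (a + b + c - + 3 * c) + + 3 * ((a - b) * (a - b))
  split₂ = solve-∀

Q≤square : ∀ a b c r → r ≤ a → r ≤ b → r ≤ c → Q a b c ≤ (a + b + c - + 3 * r) * (a + b + c - + 3 * r)
Q≤square a b c r r≤a r≤b r≤c = subst (Q a b c ≤_) (sym (split a b c r))
  (ℤₚ.i≤i+j (Q a b c) _ {{ℤ.nonNegative (nonneg-* {+ 3} (+≤+ ℕ.z≤n) cross≥0)}})
  where
  split : ∀ a b c r → (a + b + c - + 3 * r) * (a + b + c - + 3 * r)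
                    ≡ (a * a + b * b + c * c - a * b - b * c - c * a)
                      + + 3 * ((a - r) * (b - r) + (b - r) * (c - r) + (c - r) * (a - r))
  split = solve-∀
  0≤a-r = ℤₚ.i≤j⇒0≤j-i r≤a
  0≤b-r = ℤₚ.i≤j⇒0≤j-i r≤b
  0≤c-r = ℤₚ.i≤j⇒0≤j-i r≤c
  cross≥0 : 0ℤ ≤ (a - r) * (b - r) + (b - r) * (c - r) + (c - r) * (a - r)
  cross≥0 = nonneg-+ (nonneg-+ (nonneg-* 0≤a-r 0≤b-r) (nonneg-* 0≤b-r 0≤c-r)) (nonneg-* 0≤c-r 0≤a-r)

2n-3r≤0⊎[2n-3r]²≤4n : ∀ {n} (d : Fin 3 → ℕ) r β → d 0F ℕ.+ d 1F ℕ.+ d 2F ≡ 2 ℕ.* n →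
  Q (+ d 0F) (+ d 1F) (+ d 2F) ≡ + n → d β ℕ.≤ r →
  + (2 ℕ.* n) - + (3 ℕ.* r) ≤ + 0
  ⊎ (+ (2 ℕ.* n) - + (3 ℕ.* r)) * (+ (2 ℕ.* n) - + (3 ℕ.* r)) ≤ + (4 ℕ.* n)
2n-3r≤0⊎[2n-3r]²≤4n {n} d r β Σd≡2n Q≡n dβ≤r with + (2 ℕ.* n) - + (3 ℕ.* r) ℤₚ.≤? + 0
... | yes D≤0 = inj₁ D≤0
... | no D≰0 = inj₂ (begin
  D * D                                  ≤⟨ square-mono (ℤₚ.<⇒≤ (ℤₚ.≰⇒> D≰0)) D≤T ⟩
  T * T                                  ≤⟨ T²≤4Q ⟩
  + 4 * Q (+ d 0F) (+ d 1F) (+ d 2F)     ≡⟨ cong (+ 4 *_) Q≡n ⟩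
  + 4 * + n                              ≡⟨ ℤₚ.pos-* 4 n ⟨
  + (4 ℕ.* n)                            ∎)
  where
  open ℤₚ.≤-Reasoning
  D = + (2 ℕ.* n) - + (3 ℕ.* r)
  T = + (2 ℕ.* n) - + 3 * + d β
  D≤T : D ≤ T
  D≤T = ℤₚ.+-monoʳ-≤ (+ (2 ℕ.* n)) (ℤₚ.neg-mono-≤
          (subst (_≤ + (3 ℕ.* r)) (ℤₚ.pos-* 3 (d β)) (+≤+ (ℕₚ.*-monoʳ-≤ 3 dβ≤r))))
  T²≤4Q : T * T ≤ + 4 * Q (+ d 0F) (+ d 1F) (+ d 2F)
  T²≤4Q = subst (λ s → (s - + 3 * + d β) * (s - + 3 * + d β) ≤ + 4 * Q (+ d 0F) (+ d 1F) (+ d 2F))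
                (cong +_ Σd≡2n) (square≤four-Q (+_ ∘ d) β)

0≤2n-3r×n≤[2n-3r]² : ∀ {n} (d : Fin 3 → ℕ) r → d 0F ℕ.+ d 1F ℕ.+ d 2F ≡ 2 ℕ.* n →
  + n ≤ Q (+ d 0F) (+ d 1F) (+ d 2F) → (∀ β → r ℕ.≤ d β) →
  + 0 ≤ + (2 ℕ.* n) - + (3 ℕ.* r) × + n ≤ (+ (2 ℕ.* n) - + (3 ℕ.* r)) * (+ (2 ℕ.* n) - + (3 ℕ.* r))
0≤2n-3r×n≤[2n-3r]² {n} d r Σd≡2n n≤Q r≤d = ℤₚ.i≤j⇒0≤j-i (+≤+ 3r≤2n) , ℤₚ.≤-trans n≤Q Q≤D²
  where
  three-times : ∀ r → 3 ℕ.* r ≡ r ℕ.+ r ℕ.+ r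
  three-times = ℕ-Solver.solve-∀
  3r≤2n : 3 ℕ.* r ℕ.≤ 2 ℕ.* n
  3r≤2n = subst (3 ℕ.* r ℕ.≤_) Σd≡2n
    (subst (ℕ._≤ d 0F ℕ.+ d 1F ℕ.+ d 2F) (sym (three-times r))
      (ℕₚ.+-mono-≤ (ℕₚ.+-mono-≤ (r≤d 0F) (r≤d 1F)) (r≤d 2F)))
  Q≤D² : Q (+ d 0F) (+ d 1F) (+ d 2F) ≤ (+ (2 ℕ.* n) - + (3 ℕ.* r)) * (+ (2 ℕ.* n) - + (3 ℕ.* r))
  Q≤D² = subst₂ (λ s t → Q (+ d 0F) (+ d 1F) (+ d 2F) ≤ (s - t) * (s - t))
                (cong +_ Σd≡2n) (sym (ℤₚ.pos-* 3 r))
    (Q≤square (+ d 0F) (+ d 1F) (+ d 2F) (+ r) (+≤+ (r≤d 0F)) (+≤+ (r≤d 1F)) (+≤+ (r≤d 2F)))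

IsBH3⇒columns-orthogonal : ∀ {n} (L : Fin n → Fin n → Fin 3) → IsBH3 n L →
                           ∀ k l → gram (flip (entry L)) k l ≡ δ (embℕ n) k l
IsBH3⇒columns-orthogonal {n} L bh = rows⇒columns (entry L) (embℕ n) (conj-embℕ n) rows
  where
  rows : ∀ i j → gram (entry L) i j ≡ δ (embℕ n) i j
  rows i j = trans (sym (Σζ≡sum (λ k → entry L i k ⊠ conj (entry L j k)))) (bh i j)

IsBH3⇒∑-normSq≡n² : ∀ {n} (L : Fin n → Fin n → Fin 3) → IsBH3 n L → ∀ x →
                    ℤΣ.sum (λ i → normSq ⟪ entry L i , ζ^ ∘ x ⟫) ≡ + (n ℕ.* n)
IsBH3⇒∑-normSq≡n² {n} L bh x = begin
  ℤΣ.sum (normSq ∘ w)               ≡⟨ re-⟪⟫ w ⟨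
  re ⟪ w , w ⟫                       ≡⟨ cong re (parseval (entry L) (embℕ n) columns (ζ^ ∘ x)) ⟩
  re (embℕ n ⊠ ⟪ ζ^ ∘ x , ζ^ ∘ x ⟫) ≡⟨ cong (λ z → re (embℕ n ⊠ z)) (∑-ζ^⊠conj-ζ^ x) ⟩
  re (embℕ n ⊠ embℕ n)              ≡⟨ cong re (embℕ-⊠ n n) ⟩
  + (n ℕ.* n)                       ∎
  where
  open ≡-Reasoning
  columns = IsBH3⇒columns-orthogonal L bh
  w : Fin n → ℤζ
  w i = ⟪ entry L i , ζ^ ∘ x ⟫

Q-dist : ∀ {n} → (Fin n → Fin 3) → ℤ
Q-dist t = Q (+ dist t 0F) (+ dist t 1F) (+ dist t 2F)

normSq-⟪ζ^,ζ^⟫ : ∀ {n} (a x : Fin n → Fin 3) → normSq ⟪ ζ^ ∘ a , ζ^ ∘ x ⟫ ≡ Q-dist (λ k → a k ⊖ x k)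
normSq-⟪ζ^,ζ^⟫ a x = begin
  normSq ⟪ ζ^ ∘ a , ζ^ ∘ x ⟫
    ≡⟨ cong normSq (sum-cong-≗ λ k → ζ^-⊖ (a k) (x k)) ⟩
  normSq (sum (ζ^ ∘ t))
    ≡⟨ cong normSq (∑-ζ^ t) ⟩
  normSq ((+ dist t 2F - + dist t 0F) + (+ dist t 2F - + dist t 1F) ζ)
    ≡⟨ normSq-Q (+ dist t 0F) (+ dist t 1F) (+ dist t 2F) ⟩
  Q-dist t ∎
  where
  open ≡-Reasoning
  t = λ k → a k ⊖ x k

bent⇒radius-lower-bound : ∀ {n} (L : Fin n → Fin n → Fin 3) e → IsBent n L e → ∀ r →
  (∃[ c ] hamming (neg ∘ e) (codeword L (proj₁ c) (proj₂ c)) ℕ.≤ r) →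
  + (2 ℕ.* n) - + (3 ℕ.* r) ≤ + 0
  ⊎ (+ (2 ℕ.* n) - + (3 ℕ.* r)) * (+ (2 ℕ.* n) - + (3 ℕ.* r)) ≤ + (4 ℕ.* n)
bent⇒radius-lower-bound {n} L e bent r ((i , α) , close) =
  2n-3r≤0⊎[2n-3r]²≤4n (dist t) r (neg α) (dist-sum t) Q≡n
    (subst (ℕ._≤ r) (hamming-codeword (neg ∘ e) (L i) α) close)
  where
  t : Fin n → Fin 3
  t k = L i k ⊖ neg (e k)
  ζ^-⊠ : ∀ a b → ζ^ a ⊠ ζ^ b ≡ ζ^ a ⊠ conj (ζ^ (neg b))
  ζ^-⊠ a b = cong (ζ^ a ⊠_) (sym (trans (conj-ζ^ (neg b)) (cong ζ^ (neg-involutive b))))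
  Q≡n : Q-dist t ≡ + n
  Q≡n = trans (sym (normSq-⟪ζ^,ζ^⟫ (L i) (neg ∘ e)))
          (trans (cong normSq (trans (sym (sum-cong-≗ λ k → ζ^-⊠ (L i k) (e k)))
                                     (sym (Σζ≡sum (λ k → entry L i k ⊠ ζ^ (e k))))))
                 (bent i))

far-word⇒radius-upper-bound : ∀ {m} (L : Fin (suc m) → Fin (suc m) → Fin 3) → IsBH3 (suc m) L → ∀ r x →
  (∀ c → r ℕ.≤ hamming x (codeword L (proj₁ c) (proj₂ c))) →
  + 0 ≤ + (2 ℕ.* suc m) - + (3 ℕ.* r)
  × + suc m ≤ (+ (2 ℕ.* suc m) - + (3 ℕ.* r)) * (+ (2 ℕ.* suc m) - + (3 ℕ.* r))
far-word⇒radius-upper-bound {m} L bh r x far =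
  0≤2n-3r×n≤[2n-3r]² (dist t) r (dist-sum t) n≤Q r≤dist
  where
  best = pigeonhole (λ i → normSq ⟪ entry L i , ζ^ ∘ x ⟫) (suc m)
                    (ℤₚ.≤-reflexive (sym (IsBH3⇒∑-normSq≡n² L bh x)))
  i = proj₁ best
  t : Fin (suc m) → Fin 3
  t k = L i k ⊖ x k
  n≤Q : + suc m ≤ Q-dist t
  n≤Q = subst (+ suc m ≤_) (normSq-⟪ζ^,ζ^⟫ (L i) x) (proj₂ best)
  r≤dist : ∀ β → r ℕ.≤ dist t β
  r≤dist β = subst (r ℕ.≤_) (trans (hamming-codeword x (L i) (neg β)) (cong (dist t) (neg-involutive β)))
                   (far (i , neg β))

theorem5p6 : ∀ (n : ℕ) (L : Fin n → Fin n → Fin 3) →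
    IsBH3 n L → (∃[ e ] IsBent n L e) →
    ∀ (r : ℕ) → CoveringRadiusCH n L r →
      ((+ (2 Data.Nat.* n) - + (3 Data.Nat.* r)) ≤ + 0
        ⊎ (+ (2 Data.Nat.* n) - + (3 Data.Nat.* r)) * (+ (2 Data.Nat.* n) - + (3 Data.Nat.* r)) ≤ + (4 Data.Nat.* n))
      × (+ 0 ≤ (+ (2 Data.Nat.* n) - + (3 Data.Nat.* r))
        × + n ≤ (+ (2 Data.Nat.* n) - + (3 Data.Nat.* r)) * (+ (2 Data.Nat.* n) - + (3 Data.Nat.* r)))
theorem5p6 zero L _ _ r (covers , _) with () ← proj₁ (proj₁ (covers (λ ())))
theorem5p6 (suc m) L bh (e , bent) r (covers , x , far) =
  bent⇒radius-lower-bound L e bent r (covers (neg ∘ e)) , far-word⇒radius-upper-bound L bh r x far
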